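{- Let $G$ be an undirected unweighted graph on $n$ vertices with sets $A_0\supseteq\dots\supseteq A_{\log\log n-1}$ obtained by nested vertex sampling. With high probability, for every $0\le i\le \log\log n-1$, every vertex $s$, and every vertex $v \in ball_i(s)$ satisfying $|sv| \le |s\,pivot_i(s)| - 2$, the degree of $v$ is at most $\widetilde{O}(2^{2^i})$.
   Context: Nested vertex sampling: $A_0=V(G)$; $A_1$ contains each vertex independently with probability $1/2^{2^1}$; for $2\le i\le\log\log n-1$, $A_i$ contains each vertex of $A_{i-1}$ independently with probability $1/2^{2^{i-1}}$. $|sx|$ is the shortest-path distance. $pivot_i(s)$ is a vertex of $A_i$ nearest to $s$ (ties broken arbitrarily), and $ball_i(s)=\{v : |sv| < |s\,pivot_i(s)|\}$. $\widetilde{O}$ hides $\mathrm{poly}\log n$ factors; "with high probability" means probability at least $1-1/n^c$ for a constant $c>0$. -}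

module Defs where

open import Data.Bool using (Bool; true; false; _∧_; _∨_; not; if_then_else_)
open import Data.Nat as ℕ using (ℕ; zero; suc; _+_; _*_; _^_; _∸_; _<ᵇ_; _≤ᵇ_)
open import Data.Nat.Properties using (m^n≢0)
open import Data.Nat.Logarithm using (⌊log₂_⌋)
open import Data.Fin using (Fin; toℕ; _≟_)
open import Data.List using (List; []; _∷_; map; concatMap; upTo; allFin; foldr)
open import Data.Bool.ListAction using (any; all)
open import Data.Nat.ListAction using (sum)
open import Data.Vec using (Vec; []; _∷_; lookup)
open import Data.Integer using (+_)
open import Data.Rational as ℚ using (ℚ; 0ℚ; 1ℚ)
open import Relation.Nullary.Decidable using (⌊_⌋)
open import Relation.Binary.PropositionalEquality using (_≡_)

Adj : ℕ → Set
Adj n = Fin n → Fin n → Bool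

record Graph (n : ℕ) : Set where
  field
    adj  : Adj n
    sym  : ∀ u v → adj u v ≡ adj v u
    irr  : ∀ v → adj v v ≡ false
open Graph public

vertices : (n : ℕ) → List (Fin n)
vertices n = allFin n

count : ∀ {n} → (Fin n → Bool) → ℕ
count {n} p = sum (map (λ u → if p u then 1 else 0) (vertices n))

deg : ∀ {n} → Graph n → Fin n → ℕ
deg G v = count (adj G v)

-- distLe G k s v = true  iff  |sv| ≤ k  (shortest-path distance, i.e.
-- there is a path from s to v with at most k edges)
distLe : ∀ {n} → Graph n → ℕ → Fin n → Fin n → Bool
distLe G zero    s v = ⌊ s ≟ v ⌋
distLe G (suc k) s v =
  distLe G k s v ∨ any (λ u → distLe G k s u ∧ adj G u v) (vertices _)

L : ℕ → ℕ
L n = ⌊log₂ ⌊log₂ n ⌋ ⌋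

inv2^ : ℕ → ℚ
inv2^ k = (+ 1 ℚ./ (2 ^ k)) {{m^n≢0 2 k}}

-- p i = probability that a vertex of A_{i-1} is kept in A_i (i ≥ 1):
-- p 1 = 1/2^{2^1}, p i = 1/2^{2^{i-1}} for i ≥ 2.
p : ℕ → ℚ
p zero          = 1ℚ          -- unused (A_0 = V)
p (suc zero)    = inv2^ (2 ^ 1)
p (suc (suc j)) = inv2^ (2 ^ (suc j))

pIn : ℕ → ℚ
pIn zero    = 1ℚ
pIn (suc j) = pIn j ℚ.* p (suc j)

-- An outcome of the sampling assigns to every vertex its level
-- lvl v = max { i < L n | v ∈ A_i } ∈ {0, …, L n - 1}; so v ∈ A_i iff i ≤ lvl v.
Outcome : ℕ → ℕ → Set
Outcome n m = Vec (Fin m) n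

inA : ∀ {n m} → Outcome n m → ℕ → Fin n → Bool
inA ω i v = i ≤ᵇ toℕ (lookup ω v)

-- probability that a vertex gets level exactly j (out of m levels)
levelWeight : (m : ℕ) → Fin m → ℚ
levelWeight m j with suc (toℕ j) <ᵇ m
... | true  = pIn (toℕ j) ℚ.* (1ℚ ℚ.- p (suc (toℕ j)))
... | false = pIn (toℕ j)

allVecs : ∀ {A : Set} → List A → (n : ℕ) → List (Vec A n)
allVecs xs zero    = [] ∷ []
allVecs xs (suc n) = concatMap (λ x → map (x ∷_) (allVecs xs n)) xs

weight : ∀ {n m} → Outcome n m → ℚ
weight {m = m} [] = 1ℚ
weight {m = m} (j ∷ ω) = levelWeight m j ℚ.* weight ω

Pr : (n m : ℕ) → (Outcome n m → Bool) → ℚ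
Pr n m E = foldr ℚ._+_ 0ℚ
  (map (λ ω → if E ω then weight ω else 0ℚ) (allVecs (allFin m) n))

-- The bad event of the lemma, for degree bound B i (for level i):
-- there are i ≤ L n - 1, vertices s, v, and k with |sv| ≤ k and
-- |s a| > k + 1 for all a ∈ A_i (i.e. |sv| ≤ |s pivot_i(s)| - 2, which
-- also gives v ∈ ball_i(s)), such that deg v > B i.
-- (Paths have < n edges, so k ranges over 0 … n-1 without loss.)

Bad : ∀ {n} → Graph n → (ℕ → ℕ) → Outcome n (L n) → Bool
Bad {n} G B ω =
  any (λ i → any (λ s → any (λ v → any (λ k →
        distLe G k s v
      ∧ all (λ a → not (inA ω i a ∧ distLe G (suc k) s a)) (vertices n)
      ∧ (B i <ᵇ deg G v))
    (upTo n)) (vertices n)) (vertices n)) (upTo (L n))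

_^ℚ_ : ℚ → ℕ → ℚ
x ^ℚ zero  = 1ℚ
x ^ℚ suc k = x ℚ.* (x ^ℚ k)

fromℕ : ℕ → ℚ
fromℕ n = + n ℚ./ 1

{-# OPTIONS --safe #-}
module Submission where

-- Fix a level i < L n and a vertex v. If |sv| ≤ k while no vertex of A_i lies within
-- distance k + 1 of s, then no neighbour of v lies in A_i. The levels of the vertices
-- are independent and a vertex lies in A_i with probability pIn i = 2^(-2^i) (i ≥ 1),
-- so this happens with probability (1 - pIn i)^(deg v); by the Bernoulli-type
-- inequality (1 - x)^k (1 + k x) ≤ 1 that is at most 2^(-K) once deg v ≥ K 2^(2^i).
-- For K = 3 (⌊log₂ n⌋ + 1) a union bound over the L n · n pairs (i, v) gives
-- Pr[Bad] ≤ L n · n · 2^(-K) ≤ 1/n.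

module LowDegree where

  open import Data.Bool.Base using (Bool; true; false; T; not; _∧_; _∨_; if_then_else_)
  open import Data.Bool.ListAction using (and; any; all)
  open import Data.Bool.Properties using (T-∧; T-∨)
  open import Data.Fin.Base using (Fin; zero; suc; toℕ)
  open import Data.Fin.Properties using (toℕ<n)
  import Data.Integer.Base as ℤ
  import Data.Integer.Properties as ℤ
  open import Data.List.Base using (List; []; _∷_; _++_; map; foldr; concatMap; length; allFin; upTo)
  open import Data.List.Properties using (map-tabulate; map-∘; length-upTo; length-tabulate)
  open import Data.List.Relation.Unary.All as All using (All; []; _∷_)
  open import Data.List.Relation.Unary.All.Properties using (all⁺; all⁻; all-upTo; tabulate⁺)
  import Data.List.Relation.Unary.Any as Any
  import Data.List.Relation.Unary.Any.Properties as Any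
  import Data.Nat.Base as ℕ
  open ℕ using (ℕ; zero; suc)
  import Data.Nat.Coprimality as Coprime
  import Data.Nat.ListAction as ℕ
  open import Data.Nat.Logarithm using (⌊log₂_⌋; ⌊log₂⌋-mono-≤; ⌊log₂[2^n]⌋≡n)
  import Data.Nat.Properties as ℕ
  import Data.Nat.Tactic.RingSolver as ℕ-Solver
  open import Data.Product.Base using (_,_)
  open import Data.Rational.Base
    using (ℚ; mkℚ; 0ℚ; 1ℚ; ½; _+_; _*_; _-_; -_; _/_; _≤_; *≤*; nonNegative)
  open import Data.Rational.Properties
  open import Data.Sum.Base using (inj₂)
  open import Data.Vec.Base using ([]; _∷_; head; tail; lookup)
  open import Function.Base using (_∘_; id)
  open import Level using (0ℓ)
  open import Function.Bundles using (module Equivalence)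
  open Equivalence using (to; from)
  open import Relation.Binary.PropositionalEquality using (_≡_; refl; sym; trans; cong; cong₂; subst)
  open import Relation.Nullary.Decidable using (dec⇒maybe)
  open import Relation.Nullary.Negation using (contradiction)
  open import Relation.Nullary.Reflects using (ofʸ; ofⁿ)
  open import Tactic.RingSolver using (solve-∀)
  open import Tactic.RingSolver.Core.AlmostCommutativeRing using (AlmostCommutativeRing; fromCommutativeRing)

  open import Defs hiding (sym)
  open ≤-Reasoning

  ℚ-ring : AlmostCommutativeRing 0ℓ 0ℓ
  ℚ-ring = fromCommutativeRing +-*-commutativeRing (λ x → dec⇒maybe (0ℚ ≟ x))

  fromℕ≡mkℚ : ∀ n → fromℕ n ≡ mkℚ (ℤ.+ n) 0 (Coprime.sym (Coprime.1-coprimeTo n))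
  fromℕ≡mkℚ n = normalize-coprime (Coprime.sym (Coprime.1-coprimeTo n))

  fromℕ-homo-+ : ∀ m n → fromℕ (m ℕ.+ n) ≡ fromℕ m + fromℕ n
  fromℕ-homo-+ m n rewrite fromℕ≡mkℚ m | fromℕ≡mkℚ n =
    /-cong (trans (ℤ.pos-+ m n) (sym (cong₂ ℤ._+_ (ℤ.*-identityʳ (ℤ.+ m)) (ℤ.*-identityʳ (ℤ.+ n))))) refl

  fromℕ-homo-* : ∀ m n → fromℕ (m ℕ.* n) ≡ fromℕ m * fromℕ n
  fromℕ-homo-* m n rewrite fromℕ≡mkℚ m | fromℕ≡mkℚ n = /-cong (ℤ.pos-* m n) refl

  fromℕ-mono-≤ : ∀ {m n} → m ℕ.≤ n → fromℕ m ≤ fromℕ n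
  fromℕ-mono-≤ {m} {n} m≤n rewrite fromℕ≡mkℚ m | fromℕ≡mkℚ n =
    *≤* (ℤ.*-monoʳ-≤-nonNeg (ℤ.+ 1) (ℤ.+≤+ m≤n))

  fromℕ-nonNeg : ∀ n → 0ℚ ≤ fromℕ n
  fromℕ-nonNeg n = fromℕ-mono-≤ {n = n} ℕ.z≤n

  1/n*n≡1 : ∀ n .{{_ : ℕ.NonZero n}} → (ℤ.+ 1 / n) * fromℕ n ≡ 1ℚ
  1/n*n≡1 (suc n) rewrite fromℕ≡mkℚ (suc n) | normalize-coprime {1} {n} (Coprime.1-coprimeTo (suc n)) =
    *-inverseˡ (mkℚ (ℤ.+ suc n) 0 (Coprime.sym (Coprime.1-coprimeTo (suc n))))

  0≤½ : 0ℚ ≤ ½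
  0≤½ = *≤* (ℤ.+≤+ ℕ.z≤n)

  *-nonNeg : ∀ {p q} → 0ℚ ≤ p → 0ℚ ≤ q → 0ℚ ≤ p * q
  *-nonNeg {p} {q} 0≤p 0≤q =
    nonNegative⁻¹ (p * q) {{nonNeg*nonNeg⇒nonNeg p {{nonNegative 0≤p}} q {{nonNegative 0≤q}}}}

  *-mono-≤-nonNeg : ∀ {p q r s} → 0ℚ ≤ p → p ≤ q → 0ℚ ≤ r → r ≤ s → p * r ≤ q * s
  *-mono-≤-nonNeg {p} {q} {r} {s} 0≤p p≤q 0≤r r≤s = begin
    p * r  ≤⟨ *-monoˡ-≤-nonNeg p {{nonNegative 0≤p}} r≤s ⟩
    p * s  ≤⟨ *-monoʳ-≤-nonNeg s {{nonNegative (≤-trans 0≤r r≤s)}} p≤q ⟩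
    q * s  ∎

  p≤p+q : ∀ p {q} → 0ℚ ≤ q → p ≤ p + q
  p≤p+q p {q} 0≤q = begin
    p       ≡⟨ +-identityʳ p ⟨
    p + 0ℚ  ≤⟨ +-monoʳ-≤ p 0≤q ⟩
    p + q   ∎

  p-q≤p : ∀ p {q} → 0ℚ ≤ q → p - q ≤ p
  p-q≤p p {q} 0≤q = begin
    p - q   ≤⟨ +-monoʳ-≤ p (neg-antimono-≤ 0≤q) ⟩
    p - 0ℚ  ≡⟨ +-identityʳ p ⟩
    p       ∎

  p≤q⇒0≤q-p : ∀ {p q} → p ≤ q → 0ℚ ≤ q - p
  p≤q⇒0≤q-p {p} {q} p≤q = begin
    0ℚ     ≡⟨ +-inverseʳ p ⟨
    p - p  ≤⟨ +-monoˡ-≤ (- p) p≤q ⟩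
    q - p  ∎

  x*n≡1⇒x≤1 : ∀ {x} n → 0ℚ ≤ x → 1 ℕ.≤ n → x * fromℕ n ≡ 1ℚ → x ≤ 1ℚ
  x*n≡1⇒x≤1 {x} n 0≤x 1≤n x*n≡1 = begin
    x            ≡⟨ *-identityʳ x ⟨
    x * 1ℚ       ≤⟨ *-monoˡ-≤-nonNeg x {{nonNegative 0≤x}} (fromℕ-mono-≤ 1≤n) ⟩
    x * fromℕ n  ≡⟨ x*n≡1 ⟩
    1ℚ           ∎

  ^ℚ-nonNeg : ∀ {x} k → 0ℚ ≤ x → 0ℚ ≤ x ^ℚ k
  ^ℚ-nonNeg zero    0≤x = fromℕ-nonNeg 1
  ^ℚ-nonNeg (suc k) 0≤x = *-nonNeg 0≤x (^ℚ-nonNeg k 0≤x)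

  ^ℚ-≤1 : ∀ {x} k → 0ℚ ≤ x → x ≤ 1ℚ → x ^ℚ k ≤ 1ℚ
  ^ℚ-≤1 zero    0≤x x≤1 = ≤-refl
  ^ℚ-≤1 (suc k) 0≤x x≤1 = *-mono-≤-nonNeg 0≤x x≤1 (^ℚ-nonNeg k 0≤x) (^ℚ-≤1 k 0≤x x≤1)

  ^ℚ-distribˡ-+-* : ∀ x m n → x ^ℚ (m ℕ.+ n) ≡ x ^ℚ m * x ^ℚ n
  ^ℚ-distribˡ-+-* x zero    n = sym (*-identityˡ (x ^ℚ n))
  ^ℚ-distribˡ-+-* x (suc m) n =
    trans (cong (x *_) (^ℚ-distribˡ-+-* x m n)) (sym (*-assoc x (x ^ℚ m) (x ^ℚ n)))

  ^ℚ-*-assoc : ∀ x m n → (x ^ℚ m) ^ℚ n ≡ x ^ℚ (n ℕ.* m)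
  ^ℚ-*-assoc x m zero    = refl
  ^ℚ-*-assoc x m (suc n) =
    trans (cong (x ^ℚ m *_) (^ℚ-*-assoc x m n)) (sym (^ℚ-distribˡ-+-* x m (n ℕ.* m)))

  ^ℚ-monoˡ-≤ : ∀ {x y} k → 0ℚ ≤ x → x ≤ y → x ^ℚ k ≤ y ^ℚ k
  ^ℚ-monoˡ-≤ zero    0≤x x≤y = ≤-refl
  ^ℚ-monoˡ-≤ (suc k) 0≤x x≤y = *-mono-≤-nonNeg 0≤x x≤y (^ℚ-nonNeg k 0≤x) (^ℚ-monoˡ-≤ k 0≤x x≤y)

  ^ℚ-antimonoʳ-≤ : ∀ {x m n} → 0ℚ ≤ x → x ≤ 1ℚ → m ℕ.≤ n → x ^ℚ n ≤ x ^ℚ m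
  ^ℚ-antimonoʳ-≤ {x} {m} {n} 0≤x x≤1 m≤n = begin
    x ^ℚ n                   ≡⟨ cong (x ^ℚ_) (ℕ.m+[n∸m]≡n m≤n) ⟨
    x ^ℚ (m ℕ.+ (n ℕ.∸ m))   ≡⟨ ^ℚ-distribˡ-+-* x m (n ℕ.∸ m) ⟩
    x ^ℚ m * x ^ℚ (n ℕ.∸ m)  ≤⟨ *-monoˡ-≤-nonNeg (x ^ℚ m) {{nonNegative (^ℚ-nonNeg m 0≤x)}}
                                  (^ℚ-≤1 (n ℕ.∸ m) 0≤x x≤1) ⟩
    x ^ℚ m * 1ℚ              ≡⟨ *-identityʳ (x ^ℚ m) ⟩
    x ^ℚ m                   ∎

  ½^n*2^n≡1 : ∀ n → ½ ^ℚ n * fromℕ (2 ℕ.^ n) ≡ 1ℚ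
  ½^n*2^n≡1 zero    = refl
  ½^n*2^n≡1 (suc n) = begin-equality
    (½ * ½ ^ℚ n) * fromℕ (2 ℕ.* 2 ℕ.^ n)        ≡⟨ cong ((½ * ½ ^ℚ n) *_) (fromℕ-homo-* 2 (2 ℕ.^ n)) ⟩
    (½ * ½ ^ℚ n) * (fromℕ 2 * fromℕ (2 ℕ.^ n))  ≡⟨ ½-cancel (½ ^ℚ n) (fromℕ (2 ℕ.^ n)) ⟩
    ½ ^ℚ n * fromℕ (2 ℕ.^ n)                    ≡⟨ ½^n*2^n≡1 n ⟩
    1ℚ                                          ∎
    where
    ½-cancel : ∀ a b → (½ * a) * (fromℕ 2 * b) ≡ a * b
    ½-cancel = solve-∀ ℚ-ring

  bernoulli : ∀ {x} k → 0ℚ ≤ x → x ≤ 1ℚ → (1ℚ - x) ^ℚ k * (1ℚ + fromℕ k * x) ≤ 1ℚ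
  bernoulli {x} zero    0≤x x≤1 = ≤-reflexive (base x)
    where
    base : ∀ x → 1ℚ * (1ℚ + 0ℚ * x) ≡ 1ℚ
    base = solve-∀ ℚ-ring
  bernoulli {x} (suc k) 0≤x x≤1 = begin
    (1ℚ - x) * y * (1ℚ + fromℕ (suc k) * x)
      ≡⟨ cong (λ c → (1ℚ - x) * y * (1ℚ + c * x)) (fromℕ-homo-+ 1 k) ⟩
    (1ℚ - x) * y * (1ℚ + (1ℚ + fromℕ k) * x)
      ≡⟨ expand x y (fromℕ k) ⟩
    y * ((1ℚ + fromℕ k * x) - (1ℚ + fromℕ k) * (x * x))
      ≤⟨ *-monoˡ-≤-nonNeg y {{nonNegative (^ℚ-nonNeg k (p≤q⇒0≤q-p x≤1))}}
           (p-q≤p _ (*-nonNeg 0≤1+k (*-nonNeg 0≤x 0≤x))) ⟩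
    y * (1ℚ + fromℕ k * x)
      ≤⟨ bernoulli k 0≤x x≤1 ⟩
    1ℚ
      ∎
    where
    y : ℚ
    y = (1ℚ - x) ^ℚ k
    0≤1+k : 0ℚ ≤ 1ℚ + fromℕ k
    0≤1+k = +-mono-≤ (fromℕ-nonNeg 1) (fromℕ-nonNeg k)
    expand : ∀ x y k → (1ℚ - x) * y * (1ℚ + (1ℚ + k) * x) ≡ y * ((1ℚ + k * x) - (1ℚ + k) * (x * x))
    expand = solve-∀ ℚ-ring

  [1-x]^n≤½ : ∀ {x} n → 0ℚ ≤ x → x ≤ 1ℚ → fromℕ n * x ≡ 1ℚ → (1ℚ - x) ^ℚ n ≤ ½
  [1-x]^n≤½ {x} n 0≤x x≤1 nx≡1 = begin
    y                             ≡⟨ halve y ⟩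
    (y * (1ℚ + 1ℚ)) * ½           ≡⟨ cong (λ c → (y * (1ℚ + c)) * ½) nx≡1 ⟨
    (y * (1ℚ + fromℕ n * x)) * ½  ≤⟨ *-monoʳ-≤-nonNeg ½ (bernoulli n 0≤x x≤1) ⟩
    1ℚ * ½                        ≡⟨ *-identityˡ ½ ⟩
    ½                             ∎
    where
    y : ℚ
    y = (1ℚ - x) ^ℚ n
    halve : ∀ y → y ≡ (y * (1ℚ + 1ℚ)) * ½
    halve = solve-∀ ℚ-ring

  inv2^-nonNeg : ∀ k → 0ℚ ≤ inv2^ k
  inv2^-nonNeg k = nonNegative⁻¹ (inv2^ k) {{normalize-nonNeg 1 (2 ℕ.^ k) {{ℕ.m^n≢0 2 k}}}}

  inv2^-inverse : ∀ k → inv2^ k * fromℕ (2 ℕ.^ k) ≡ 1ℚ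
  inv2^-inverse k = 1/n*n≡1 (2 ℕ.^ k) {{ℕ.m^n≢0 2 k}}

  inv2^≤1 : ∀ k → inv2^ k ≤ 1ℚ
  inv2^≤1 k = x*n≡1⇒x≤1 (2 ℕ.^ k) (inv2^-nonNeg k) (ℕ.m^n>0 2 k) (inv2^-inverse k)

  p-nonNeg : ∀ i → 0ℚ ≤ p i
  p-nonNeg zero          = fromℕ-nonNeg 1
  p-nonNeg (suc zero)    = inv2^-nonNeg 2
  p-nonNeg (suc (suc i)) = inv2^-nonNeg (2 ℕ.^ suc i)

  p≤1 : ∀ i → p i ≤ 1ℚ
  p≤1 zero          = ≤-refl
  p≤1 (suc zero)    = inv2^≤1 2
  p≤1 (suc (suc i)) = inv2^≤1 (2 ℕ.^ suc i)

  pIn-nonNeg : ∀ i → 0ℚ ≤ pIn i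
  pIn-nonNeg zero    = fromℕ-nonNeg 1
  pIn-nonNeg (suc i) = *-nonNeg (pIn-nonNeg i) (p-nonNeg (suc i))

  pIn≤1 : ∀ i → pIn i ≤ 1ℚ
  pIn≤1 zero    = ≤-refl
  pIn≤1 (suc i) = *-mono-≤-nonNeg (pIn-nonNeg i) (pIn≤1 i) (p-nonNeg (suc i)) (p≤1 (suc i))

  pIn-inverse : ∀ i → pIn (suc i) * fromℕ (2 ℕ.^ 2 ℕ.^ suc i) ≡ 1ℚ
  pIn-inverse zero    = refl
  pIn-inverse (suc i) = begin-equality
    pIn (suc i) * inv2^ N * fromℕ (2 ℕ.^ (N ℕ.+ (N ℕ.+ 0)))
      ≡⟨ cong (λ e → pIn (suc i) * inv2^ N * fromℕ e) 2^[N+N]≡X*X ⟩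
    pIn (suc i) * inv2^ N * fromℕ (X ℕ.* X)
      ≡⟨ cong (pIn (suc i) * inv2^ N *_) (fromℕ-homo-* X X) ⟩
    pIn (suc i) * inv2^ N * (fromℕ X * fromℕ X)
      ≡⟨ regroup (pIn (suc i)) (inv2^ N) (fromℕ X) ⟩
    (pIn (suc i) * fromℕ X) * (inv2^ N * fromℕ X)
      ≡⟨ cong₂ _*_ (pIn-inverse i) (inv2^-inverse N) ⟩
    1ℚ
      ∎
    where
    N X : ℕ
    N = 2 ℕ.^ suc i
    X = 2 ℕ.^ N
    2^[N+N]≡X*X : 2 ℕ.^ (N ℕ.+ (N ℕ.+ 0)) ≡ X ℕ.* X
    2^[N+N]≡X*X = trans (cong (λ e → 2 ℕ.^ (N ℕ.+ e)) (ℕ.+-identityʳ N)) (ℕ.^-distribˡ-+-* 2 N N)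
    regroup : ∀ a b c → a * b * (c * c) ≡ (a * c) * (b * c)
    regroup = solve-∀ ℚ-ring

  [1-pIn]^2^2^i≤½ : ∀ i → (1ℚ - pIn i) ^ℚ (2 ℕ.^ 2 ℕ.^ i) ≤ ½
  [1-pIn]^2^2^i≤½ zero    = 0≤½   -- pIn 0 = 1 (A_0 = V), so the left side computes to 0
  [1-pIn]^2^2^i≤½ (suc i) =
    [1-x]^n≤½ N (pIn-nonNeg (suc i)) (pIn≤1 (suc i)) (trans (*-comm (fromℕ N) (pIn (suc i))) (pIn-inverse i))
    where
    N : ℕ
    N = 2 ℕ.^ 2 ℕ.^ suc i

  [1-pIn]^[k*2^2^i]≤½^k : ∀ i k → (1ℚ - pIn i) ^ℚ (k ℕ.* 2 ℕ.^ 2 ℕ.^ i) ≤ ½ ^ℚ k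
  [1-pIn]^[k*2^2^i]≤½^k i k = begin
    (1ℚ - pIn i) ^ℚ (k ℕ.* N)  ≡⟨ ^ℚ-*-assoc (1ℚ - pIn i) N k ⟨
    ((1ℚ - pIn i) ^ℚ N) ^ℚ k   ≤⟨ ^ℚ-monoˡ-≤ k (^ℚ-nonNeg N (p≤q⇒0≤q-p (pIn≤1 i))) ([1-pIn]^2^2^i≤½ i) ⟩
    ½ ^ℚ k                     ∎
    where
    N : ℕ
    N = 2 ℕ.^ 2 ℕ.^ i

  indicator : Bool → ℚ → ℚ
  indicator b x = if b then x else 0ℚ

  indicator-*ˡ : ∀ b {c x} → indicator b (c * x) ≡ c * indicator b x
  indicator-*ˡ true      = refl
  indicator-*ˡ false {c} = sym (*-zeroʳ c)

  sumOver : ∀ {A : Set} → (A → ℚ) → List A → ℚ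
  sumOver f xs = foldr _+_ 0ℚ (map f xs)

  module _ {A : Set} where

    sumOver-cong : ∀ {f g : A → ℚ} xs → (∀ x → f x ≡ g x) → sumOver f xs ≡ sumOver g xs
    sumOver-cong []       f≗g = refl
    sumOver-cong (x ∷ xs) f≗g = cong₂ _+_ (f≗g x) (sumOver-cong xs f≗g)

    sumOver-mono-≤ : ∀ {f g : A → ℚ} xs → (∀ x → f x ≤ g x) → sumOver f xs ≤ sumOver g xs
    sumOver-mono-≤ []       f≤g = ≤-refl
    sumOver-mono-≤ (x ∷ xs) f≤g = +-mono-≤ (f≤g x) (sumOver-mono-≤ xs f≤g)

    sumOver-zero : ∀ (xs : List A) → sumOver (λ _ → 0ℚ) xs ≡ 0ℚ
    sumOver-zero []       = refl
    sumOver-zero (x ∷ xs) = trans (+-identityˡ _) (sumOver-zero xs)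

    sumOver-distrib-+ : ∀ (f g : A → ℚ) xs → sumOver (λ x → f x + g x) xs ≡ sumOver f xs + sumOver g xs
    sumOver-distrib-+ f g []       = refl
    sumOver-distrib-+ f g (x ∷ xs) =
      trans (cong ((f x + g x) +_) (sumOver-distrib-+ f g xs))
            (interchange (f x) (g x) (sumOver f xs) (sumOver g xs))
      where
      interchange : ∀ a b c d → (a + b) + (c + d) ≡ (a + c) + (b + d)
      interchange = solve-∀ ℚ-ring

    sumOver-*ˡ : ∀ c (f : A → ℚ) xs → sumOver (λ x → c * f x) xs ≡ c * sumOver f xs
    sumOver-*ˡ c f []       = sym (*-zeroʳ c)
    sumOver-*ˡ c f (x ∷ xs) =
      trans (cong ((c * f x) +_) (sumOver-*ˡ c f xs)) (sym (*-distribˡ-+ c (f x) (sumOver f xs)))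

    sumOver-*ʳ : ∀ (f : A → ℚ) c xs → sumOver (λ x → f x * c) xs ≡ sumOver f xs * c
    sumOver-*ʳ f c []       = sym (*-zeroˡ c)
    sumOver-*ʳ f c (x ∷ xs) =
      trans (cong ((f x * c) +_) (sumOver-*ʳ f c xs)) (sym (*-distribʳ-+ c (f x) (sumOver f xs)))

    sumOver-++ : ∀ (f : A → ℚ) xs ys → sumOver f (xs ++ ys) ≡ sumOver f xs + sumOver f ys
    sumOver-++ f []       ys = sym (+-identityˡ (sumOver f ys))
    sumOver-++ f (x ∷ xs) ys =
      trans (cong (f x +_) (sumOver-++ f xs ys)) (sym (+-assoc (f x) (sumOver f xs) (sumOver f ys)))

    sumOver-≤-length : ∀ {f : A → ℚ} {c} xs → All (λ x → f x ≤ c) xs → sumOver f xs ≤ fromℕ (length xs) * c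
    sumOver-≤-length {c = c} []       []             = ≤-reflexive (sym (*-zeroˡ c))
    sumOver-≤-length {f} {c} (x ∷ xs) (fx≤c ∷ fxs≤c) = begin
      f x + sumOver f xs            ≤⟨ +-mono-≤ fx≤c (sumOver-≤-length xs fxs≤c) ⟩
      c + fromℕ (length xs) * c     ≡⟨ factor c (fromℕ (length xs)) ⟩
      (1ℚ + fromℕ (length xs)) * c  ≡⟨ cong (_* c) (fromℕ-homo-+ 1 (length xs)) ⟨
      fromℕ (length (x ∷ xs)) * c   ∎
      where
      factor : ∀ c l → c + l * c ≡ (1ℚ + l) * c
      factor = solve-∀ ℚ-ring

  sumOver-map : ∀ {A B : Set} (f : B → ℚ) (g : A → B) xs → sumOver f (map g xs) ≡ sumOver (f ∘ g) xs
  sumOver-map f g xs = cong (foldr _+_ 0ℚ) (sym (map-∘ xs))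

  sumOver-concatMap : ∀ {A B : Set} (f : B → ℚ) (g : A → List B) xs →
                      sumOver f (concatMap g xs) ≡ sumOver (λ x → sumOver f (g x)) xs
  sumOver-concatMap f g []       = refl
  sumOver-concatMap f g (x ∷ xs) =
    trans (sumOver-++ f (g x) (concatMap g xs)) (cong (sumOver f (g x) +_) (sumOver-concatMap f g xs))

  map-allFin-suc : ∀ {B : Set} n (f : Fin (suc n) → B) →
                   map f (allFin (suc n)) ≡ f zero ∷ map (f ∘ suc) (allFin n)
  map-allFin-suc n f = cong (f zero ∷_) (trans (map-tabulate suc f) (sym (map-tabulate id (f ∘ suc))))

  telescope : ∀ (a : ℕ → ℚ) m → sumOver (λ j → a (toℕ j) - a (suc (toℕ j))) (allFin m) ≡ a 0 - a m
  telescope a zero    = sym (+-inverseʳ (a 0))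
  telescope a (suc m) = begin-equality
    sumOver (λ j → a (toℕ j) - a (suc (toℕ j))) (allFin (suc m))
      ≡⟨ cong (foldr _+_ 0ℚ) (map-allFin-suc m (λ j → a (toℕ j) - a (suc (toℕ j)))) ⟩
    (a 0 - a 1) + sumOver (λ j → a (suc (toℕ j)) - a (suc (suc (toℕ j)))) (allFin m)
      ≡⟨ cong ((a 0 - a 1) +_) (telescope (a ∘ suc) m) ⟩
    (a 0 - a 1) + (a 1 - a (suc m))
      ≡⟨ cancel (a 0) (a 1) (a (suc m)) ⟩
    a 0 - a (suc m)
      ∎
    where
    cancel : ∀ x y z → (x - y) + (y - z) ≡ x - z
    cancel = solve-∀ ℚ-ring

  -- The level of a single vertex

  levelProb : ∀ m → (Fin m → Bool) → ℚ
  levelProb m S = sumOver (λ j → indicator (S j) (levelWeight m j)) (allFin m)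

  levelsOfA : ∀ {m} → ℕ → Fin m → Bool
  levelsOfA i j = i ℕ.≤ᵇ toℕ j

  -- The probability of lying in A_t (which is empty for t ≥ m); the level weights are its
  -- successive differences.
  probInA : ℕ → ℕ → ℚ
  probInA m t = if t ℕ.<ᵇ m then pIn t else 0ℚ

  probInA-< : ∀ {m t} → t ℕ.< m → probInA m t ≡ pIn t
  probInA-< {m} {t} t<m with t ℕ.<ᵇ m | ℕ.<ᵇ-reflects-< t m
  ... | true  | _       = refl
  ... | false | ofⁿ t≮m = contradiction t<m t≮m

  probInA-≥ : ∀ {m t} → m ℕ.≤ t → probInA m t ≡ 0ℚ
  probInA-≥ {m} {t} m≤t with t ℕ.<ᵇ m | ℕ.<ᵇ-reflects-< t m
  ... | true  | ofʸ t<m = contradiction m≤t (ℕ.<⇒≱ t<m)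
  ... | false | _       = refl

  levelWeight≡probInA-diff : ∀ m (j : Fin m) → levelWeight m j ≡ probInA m (toℕ j) - probInA m (suc (toℕ j))
  levelWeight≡probInA-diff m j rewrite probInA-< (toℕ<n j) with suc (toℕ j) ℕ.<ᵇ m
  ... | true  = keep-split (pIn (toℕ j)) (p (suc (toℕ j)))
    where
    keep-split : ∀ a b → a * (1ℚ - b) ≡ a - a * b
    keep-split = solve-∀ ℚ-ring
  ... | false = sym (+-identityʳ (pIn (toℕ j)))

  levelWeight-nonNeg : ∀ m j → 0ℚ ≤ levelWeight m j
  levelWeight-nonNeg m j with suc (toℕ j) ℕ.<ᵇ m
  ... | true  = *-nonNeg (pIn-nonNeg (toℕ j)) (p≤q⇒0≤q-p (p≤1 (suc (toℕ j))))
  ... | false = pIn-nonNeg (toℕ j)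

  levelProb-all : ∀ m .{{_ : ℕ.NonZero m}} → levelProb m (λ _ → true) ≡ 1ℚ
  levelProb-all m@(suc _) = begin-equality
    levelProb m (λ _ → true)
      ≡⟨ sumOver-cong (allFin m) (levelWeight≡probInA-diff m) ⟩
    sumOver (λ j → probInA m (toℕ j) - probInA m (suc (toℕ j))) (allFin m)
      ≡⟨ telescope (probInA m) m ⟩
    1ℚ - probInA m m
      ≡⟨ cong (λ q → 1ℚ - q) (probInA-≥ {m} ℕ.≤-refl) ⟩
    1ℚ
      ∎

  -- Cutting a telescoping sum off below i gives a telescoping sum along t ⊓ i.
  restrict-telescope : ∀ (a : ℕ → ℚ) i t →
    indicator (not (i ℕ.≤ᵇ t)) (a t - a (suc t)) ≡ a (t ℕ.⊓ i) - a (suc t ℕ.⊓ i)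
  restrict-telescope a i t with i ℕ.≤ᵇ t | ℕ.≤ᵇ-reflects-≤ i t
  ... | true  | ofʸ i≤t
    rewrite ℕ.m≥n⇒m⊓n≡n i≤t | ℕ.m≥n⇒m⊓n≡n (ℕ.m≤n⇒m≤1+n i≤t) = sym (+-inverseʳ (a i))
  ... | false | ofⁿ i≰t
    rewrite ℕ.m≤n⇒m⊓n≡m (ℕ.<⇒≤ (ℕ.≰⇒> i≰t)) | ℕ.m≤n⇒m⊓n≡m (ℕ.≰⇒> i≰t) = refl

  levelProb-notInA : ∀ {m i} → i ℕ.< m → levelProb m (not ∘ levelsOfA i) ≡ 1ℚ - pIn i
  levelProb-notInA {m} {i} i<m = begin-equality
    levelProb m (not ∘ levelsOfA i)
      ≡⟨ sumOver-cong (allFin m) restrict ⟩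
    sumOver (λ j → a (toℕ j) - a (suc (toℕ j))) (allFin m)
      ≡⟨ telescope a m ⟩
    probInA m 0 - probInA m (m ℕ.⊓ i)
      ≡⟨ cong₂ _-_ (probInA-< (ℕ.≤-<-trans ℕ.z≤n i<m))
                   (trans (cong (probInA m) (ℕ.m≥n⇒m⊓n≡n (ℕ.<⇒≤ i<m))) (probInA-< i<m)) ⟩
    1ℚ - pIn i
      ∎
    where
    a : ℕ → ℚ
    a t = probInA m (t ℕ.⊓ i)
    restrict : ∀ j → indicator (not (levelsOfA i j)) (levelWeight m j) ≡ a (toℕ j) - a (suc (toℕ j))
    restrict j = trans (cong (indicator (not (levelsOfA i j))) (levelWeight≡probInA-diff m j))
                       (restrict-telescope (probInA m) i (toℕ j))

  weight-nonNeg : ∀ {n m} (ω : Outcome n m) → 0ℚ ≤ weight ω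
  weight-nonNeg         []      = fromℕ-nonNeg 1
  weight-nonNeg {m = m} (j ∷ ω) = *-nonNeg (levelWeight-nonNeg m j) (weight-nonNeg ω)

  -- Probabilities of events

  module _ {n m : ℕ} where

    Pr-cong : ∀ {E F : Outcome n m → Bool} → (∀ ω → E ω ≡ F ω) → Pr n m E ≡ Pr n m F
    Pr-cong E≗F = sumOver-cong (allVecs (allFin m) n) (λ ω → cong (λ b → indicator b (weight ω)) (E≗F ω))

    Pr-mono : ∀ {E F : Outcome n m → Bool} → (∀ ω → T (E ω) → T (F ω)) → Pr n m E ≤ Pr n m F
    Pr-mono {E} {F} E⇒F = sumOver-mono-≤ (allVecs (allFin m) n) pointwise
      where
      pointwise : ∀ ω → indicator (E ω) (weight ω) ≤ indicator (F ω) (weight ω)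
      pointwise ω with E ω | F ω | E⇒F ω
      ... | true  | true  | _    = ≤-refl
      ... | true  | false | E⇒F′ = contradiction (E⇒F′ _) λ ()
      ... | false | true  | _    = weight-nonNeg ω
      ... | false | false | _    = ≤-refl

    Pr-false : Pr n m (λ _ → false) ≡ 0ℚ
    Pr-false = sumOver-zero (allVecs (allFin m) n)

    Pr-∨ : ∀ (E F : Outcome n m → Bool) → Pr n m (λ ω → E ω ∨ F ω) ≤ Pr n m E + Pr n m F
    Pr-∨ E F = begin
      Pr n m (λ ω → E ω ∨ F ω)
        ≤⟨ sumOver-mono-≤ Ω pointwise ⟩
      sumOver (λ ω → indicator (E ω) (weight ω) + indicator (F ω) (weight ω)) Ω
        ≡⟨ sumOver-distrib-+ _ _ Ω ⟩
      Pr n m E + Pr n m F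
        ∎
      where
      Ω : List (Outcome n m)
      Ω = allVecs (allFin m) n
      pointwise : ∀ ω → indicator (E ω ∨ F ω) (weight ω)
                      ≤ indicator (E ω) (weight ω) + indicator (F ω) (weight ω)
      pointwise ω with E ω | F ω
      ... | true  | true  = p≤p+q (weight ω) (weight-nonNeg ω)
      ... | true  | false = ≤-reflexive (sym (+-identityʳ (weight ω)))
      ... | false | true  = ≤-reflexive (sym (+-identityˡ (weight ω)))
      ... | false | false = ≤-refl

    Pr-any : ∀ {A : Set} (E : A → Outcome n m → Bool) xs →
             Pr n m (λ ω → any (λ x → E x ω) xs) ≤ sumOver (λ x → Pr n m (E x)) xs
    Pr-any E []       = ≤-reflexive Pr-false
    Pr-any E (x ∷ xs) = ≤-trans (Pr-∨ (E x) _) (+-monoʳ-≤ (Pr n m (E x)) (Pr-any E xs))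

    Pr-guard : ∀ {c} b (E : Outcome n m → Bool) → 0ℚ ≤ c → (T b → Pr n m E ≤ c) → Pr n m (λ ω → b ∧ E ω) ≤ c
    Pr-guard true  E 0≤c E≤c = E≤c _
    Pr-guard false E 0≤c E≤c = ≤-trans (≤-reflexive Pr-false) 0≤c

  Pr-head∧tail : ∀ {n m} (g : Fin m → Bool) (E : Outcome n m → Bool) →
                 Pr (suc n) m (λ ω → g (head ω) ∧ E (tail ω)) ≡ levelProb m g * Pr n m E
  Pr-head∧tail {n} {m} g E = begin-equality
    Pr (suc n) m (λ ω → g (head ω) ∧ E (tail ω))
      ≡⟨ sumOver-concatMap h (λ x → map (x ∷_) Ω) (allFin m) ⟩
    sumOver (λ x → sumOver h (map (x ∷_) Ω)) (allFin m)
      ≡⟨ sumOver-cong (allFin m) (λ x → trans (sumOver-map h (x ∷_) Ω) (fibre x)) ⟩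
    sumOver (λ x → indicator (g x) (levelWeight m x) * Pr n m E) (allFin m)
      ≡⟨ sumOver-*ʳ _ (Pr n m E) (allFin m) ⟩
    levelProb m g * Pr n m E
      ∎
    where
    Ω : List (Outcome n m)
    Ω = allVecs (allFin m) n
    h : Outcome (suc n) m → ℚ
    h ω = indicator (g (head ω) ∧ E (tail ω)) (weight ω)
    fibre : ∀ x → sumOver (λ ω → indicator (g x ∧ E ω) (levelWeight m x * weight ω)) Ω
                ≡ indicator (g x) (levelWeight m x) * Pr n m E
    fibre x with g x
    ... | true  = trans (sumOver-cong Ω (λ ω → indicator-*ˡ (E ω) {levelWeight m x} {weight ω}))
                        (sumOver-*ˡ (levelWeight m x) _ Ω)
    ... | false = trans (sumOver-zero Ω) (sym (*-zeroˡ (Pr n m E)))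

  avoids : ∀ {n m} → (Fin n → Bool) → (Fin m → Bool) → Outcome n m → Bool
  avoids {n} N S ω = all (λ u → not (N u ∧ S (lookup ω u))) (vertices n)

  count-suc : ∀ {n} (N : Fin (suc n) → Bool) → count N ≡ (if N zero then 1 else 0) ℕ.+ count (N ∘ suc)
  count-suc {n} N = cong ℕ.sum (map-allFin-suc n (λ u → if N u then 1 else 0))

  Pr-avoids : ∀ {m} .{{_ : ℕ.NonZero m}} n (N : Fin n → Bool) (S : Fin m → Bool) →
              Pr n m (avoids N S) ≡ levelProb m (not ∘ S) ^ℚ count N
  Pr-avoids     zero    N S = refl
  Pr-avoids {m} (suc n) N S = begin-equality
    Pr (suc n) m (avoids N S)
      ≡⟨ Pr-cong split ⟩
    Pr (suc n) m (λ ω → not (N zero ∧ S (head ω)) ∧ avoids (N ∘ suc) S (tail ω))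
      ≡⟨ Pr-head∧tail (λ j → not (N zero ∧ S j)) (avoids (N ∘ suc) S) ⟩
    levelProb m (λ j → not (N zero ∧ S j)) * Pr n m (avoids (N ∘ suc) S)
      ≡⟨ cong (levelProb m (λ j → not (N zero ∧ S j)) *_) (Pr-avoids n (N ∘ suc) S) ⟩
    levelProb m (λ j → not (N zero ∧ S j)) * q ^ℚ count (N ∘ suc)
      ≡⟨ first-vertex (N zero) ⟩
    q ^ℚ ((if N zero then 1 else 0) ℕ.+ count (N ∘ suc))
      ≡⟨ cong (q ^ℚ_) (count-suc N) ⟨
    q ^ℚ count N
      ∎
    where
    q : ℚ
    q = levelProb m (not ∘ S)
    split : ∀ ω → avoids N S ω ≡ not (N zero ∧ S (head ω)) ∧ avoids (N ∘ suc) S (tail ω)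
    split (x ∷ ω) = cong and (map-allFin-suc n (λ u → not (N u ∧ S (lookup (x ∷ ω) u))))
    first-vertex : ∀ b → levelProb m (λ j → not (b ∧ S j)) * q ^ℚ count (N ∘ suc)
                         ≡ q ^ℚ ((if b then 1 else 0) ℕ.+ count (N ∘ suc))
    first-vertex true  = refl
    first-vertex false = trans (cong (_* q ^ℚ count (N ∘ suc)) (levelProb-all m)) (*-identityˡ _)

  Pr-missesA : ∀ {n m i} → i ℕ.< m → (N : Fin n → Bool) →
               Pr n m (avoids N (levelsOfA i)) ≡ (1ℚ - pIn i) ^ℚ count N
  Pr-missesA {n} i<m N = trans (Pr-avoids {{ℕ.>-nonZero (ℕ.≤-<-trans ℕ.z≤n i<m)}} n N _)
                               (cong (_^ℚ count N) (levelProb-notInA i<m))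

  -- High-degree vertices without a neighbour in A_i

  ¬-∧-contra : ∀ {a b c} → (T b → T c) → T (not (a ∧ c)) → T (not (b ∧ a))
  ¬-∧-contra {false} {false}         _   _  = _
  ¬-∧-contra {false} {true}          _   _  = _
  ¬-∧-contra {true}  {false}         _   _  = _
  ¬-∧-contra {true}  {true}  {true}  _   ()
  ¬-∧-contra {true}  {true}  {false} b⇒c _  = b⇒c _

  module _ {n} (G : Graph n) where

    distLe-step : ∀ k {s v u} → T (distLe G k s v) → T (adj G v u) → T (distLe G (suc k) s u)
    distLe-step k {v = v} s~v v~u = from T-∨ (inj₂ (Any.any⁺ _ (Any.tabulate⁺ v (from T-∧ (s~v , v~u)))))

    ball-avoids-neighbourhood : ∀ {m} (S : Fin m → Bool) ω k {s v} → T (distLe G k s v) →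
                                T (all (λ a → not (S (lookup ω a) ∧ distLe G (suc k) s a)) (vertices n)) →
                                T (avoids (adj G v) S ω)
    ball-avoids-neighbourhood S ω k s~v ball-free =
      all⁻ _ (All.map (¬-∧-contra (distLe-step k s~v)) (all⁺ _ (vertices n) ball-free))

    missedHub : ∀ {m} → (ℕ → ℕ) → ℕ → Fin n → Outcome n m → Bool
    missedHub B i v ω = (B i ℕ.<ᵇ deg G v) ∧ avoids (adj G v) (levelsOfA i) ω

    ballWitness : (ℕ → ℕ) → Outcome n (L n) → ℕ → Fin n → Fin n → ℕ → Bool
    ballWitness B ω i s v k =
        distLe G k s v
      ∧ all (λ a → not (inA ω i a ∧ distLe G (suc k) s a)) (vertices n)
      ∧ (B i ℕ.<ᵇ deg G v)

    ballWitness⇒missedHub : ∀ B ω i s v k → T (ballWitness B ω i s v k) → T (missedHub B i v ω)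
    ballWitness⇒missedHub B ω i s v k w =
      let s~v , rest        = to T-∧ w
          ball-free , heavy = to T-∧ rest
      in from T-∧ (heavy , ball-avoids-neighbourhood (levelsOfA i) ω k s~v ball-free)

    Bad⇒missedHub : ∀ B ω → T (Bad G B ω) →
                    T (any (λ i → any (λ v → missedHub B i v ω) (vertices n)) (upTo (L n)))
    Bad⇒missedHub B ω bad =
      Any.any⁺ (λ i → any (λ v → missedHub B i v ω) (vertices n))
               (Any.map level (Any.any⁻ _ (upTo (L n)) bad))
      where
      level : ∀ {i} →
              T (any (λ s → any (λ v → any (ballWitness B ω i s v) (upTo n)) (vertices n)) (vertices n)) →
              T (any (λ v → missedHub B i v ω) (vertices n))
      level {i} h =
        let s , hs = Any.satisfied (Any.any⁻ _ (vertices n) h)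
            v , hv = Any.satisfied (Any.any⁻ _ (vertices n) hs)
            k , hk = Any.satisfied (Any.any⁻ _ (upTo n) hv)
        in Any.any⁺ _ (Any.tabulate⁺ v (ballWitness⇒missedHub B ω i s v k hk))

  Pr-missedHub : ∀ {n m} (G : Graph n) B i v → i ℕ.< m → Pr n m (missedHub G B i v) ≤ (1ℚ - pIn i) ^ℚ B i
  Pr-missedHub {n} {m} G B i v i<m =
    Pr-guard (B i ℕ.<ᵇ deg G v) (avoids (adj G v) (levelsOfA i)) (^ℚ-nonNeg (B i) 0≤1-pIn) heavy
    where
    0≤1-pIn : 0ℚ ≤ 1ℚ - pIn i
    0≤1-pIn = p≤q⇒0≤q-p (pIn≤1 i)
    heavy : T (B i ℕ.<ᵇ deg G v) → Pr n m (avoids (adj G v) (levelsOfA i)) ≤ (1ℚ - pIn i) ^ℚ B i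
    heavy B<deg = begin
      Pr n m (avoids (adj G v) (levelsOfA i))  ≡⟨ Pr-missesA i<m (adj G v) ⟩
      (1ℚ - pIn i) ^ℚ deg G v                  ≤⟨ ^ℚ-antimonoʳ-≤ 0≤1-pIn (p-q≤p 1ℚ (pIn-nonNeg i))
                                                    (ℕ.<⇒≤ (ℕ.<ᵇ⇒< (B i) (deg G v) B<deg)) ⟩
      (1ℚ - pIn i) ^ℚ B i                      ∎

  Pr-Bad≤ : ∀ {n} (G : Graph n) B {c} → (∀ {i} → i ℕ.< L n → (1ℚ - pIn i) ^ℚ B i ≤ c) →
            Pr n (L n) (Bad G B) ≤ fromℕ (L n) * (fromℕ n * c)
  Pr-Bad≤ {n} G B {c} bound = begin
    Pr n m (Bad G B)
      ≤⟨ Pr-mono (Bad⇒missedHub G B) ⟩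
    Pr n m (λ ω → any (λ i → any (λ v → missedHub G B i v ω) (vertices n)) (upTo m))
      ≤⟨ Pr-any (λ i ω → any (λ v → missedHub G B i v ω) (vertices n)) (upTo m) ⟩
    sumOver (λ i → Pr n m (λ ω → any (λ v → missedHub G B i v ω) (vertices n))) (upTo m)
      ≤⟨ sumOver-≤-length (upTo m) (All.map level (all-upTo m)) ⟩
    fromℕ (length (upTo m)) * (fromℕ n * c)
      ≡⟨ cong (λ l → fromℕ l * (fromℕ n * c)) (length-upTo m) ⟩
    fromℕ m * (fromℕ n * c)
      ∎
    where
    m : ℕ
    m = L n
    level : ∀ {i} → i ℕ.< m → Pr n m (λ ω → any (λ v → missedHub G B i v ω) (vertices n)) ≤ fromℕ n * c
    level {i} i<m = begin
      Pr n m (λ ω → any (λ v → missedHub G B i v ω) (vertices n))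
        ≤⟨ Pr-any (missedHub G B i) (vertices n) ⟩
      sumOver (λ v → Pr n m (missedHub G B i v)) (vertices n)
        ≤⟨ sumOver-≤-length (vertices n) (tabulate⁺ vertex) ⟩
      fromℕ (length (vertices n)) * c
        ≡⟨ cong (λ l → fromℕ l * c) (length-tabulate {n = n} id) ⟩
      fromℕ n * c
        ∎
      where
      vertex : ∀ v → Pr n m (missedHub G B i v) ≤ c
      vertex v = ≤-trans (Pr-missedHub G B i v i<m) (bound i<m)

  n<2^n : ∀ n → n ℕ.< 2 ℕ.^ n
  n<2^n zero    = ℕ.z<s
  n<2^n (suc n) = ℕ.+-mono-≤-< (ℕ.m^n>0 2 n) (ℕ.<-≤-trans (n<2^n n) (ℕ.m≤m+n (2 ℕ.^ n) 0))

  ⌊log₂n⌋≤n : ∀ n → ⌊log₂ n ⌋ ℕ.≤ n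
  ⌊log₂n⌋≤n n = ℕ.≤-trans (⌊log₂⌋-mono-≤ (ℕ.<⇒≤ (n<2^n n))) (ℕ.≤-reflexive (⌊log₂[2^n]⌋≡n n))

  n<2^[1+⌊log₂n⌋] : ∀ n → n ℕ.< 2 ℕ.^ suc ⌊log₂ n ⌋
  n<2^[1+⌊log₂n⌋] n = ℕ.≰⇒> λ 2^[1+ℓ]≤n →
    ℕ.1+n≰n (subst (ℕ._≤ ⌊log₂ n ⌋) (⌊log₂[2^n]⌋≡n (suc ⌊log₂ n ⌋)) (⌊log₂⌋-mono-≤ 2^[1+ℓ]≤n))

  module _ (n : ℕ) (G : Graph n) where

    ℓ K : ℕ
    ℓ = ⌊log₂ n ⌋
    K = (ℓ ℕ.+ 1) ℕ.* 3

    B : ℕ → ℕ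
    B i = 3 ℕ.* 2 ℕ.^ (2 ℕ.^ i) ℕ.* (⌊log₂ n ⌋ ℕ.+ 1) ℕ.^ 1

    [1-pIn]^B≤½^K : ∀ {i} → i ℕ.< L n → (1ℚ - pIn i) ^ℚ B i ≤ ½ ^ℚ K
    [1-pIn]^B≤½^K {i} _ =
      subst (λ e → (1ℚ - pIn i) ^ℚ e ≤ ½ ^ℚ K) (sym (B≡K*N (2 ℕ.^ 2 ℕ.^ i) (ℓ ℕ.+ 1)))
            ([1-pIn]^[k*2^2^i]≤½^k i K)
      where
      B≡K*N : ∀ x y → 3 ℕ.* x ℕ.* (y ℕ.* 1) ≡ y ℕ.* 3 ℕ.* x
      B≡K*N = ℕ-Solver.solve-∀

    L*n*n≤2^K : L n ℕ.* n ℕ.* n ℕ.≤ 2 ℕ.^ K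
    L*n*n≤2^K = ℕ.≤-trans (ℕ.*-mono-≤ (ℕ.*-mono-≤ (ℕ.≤-trans L≤n n≤X) n≤X) n≤X)
                          (ℕ.≤-reflexive (trans (cube X) (ℕ.^-*-assoc 2 (ℓ ℕ.+ 1) 3)))
      where
      X : ℕ
      X = 2 ℕ.^ (ℓ ℕ.+ 1)
      L≤n : L n ℕ.≤ n
      L≤n = ℕ.≤-trans (⌊log₂n⌋≤n ℓ) (⌊log₂n⌋≤n n)
      n≤X : n ℕ.≤ X
      n≤X = ℕ.<⇒≤ (subst (λ e → n ℕ.< 2 ℕ.^ e) (ℕ.+-comm 1 ℓ) (n<2^[1+⌊log₂n⌋] n))
      cube : ∀ x → x ℕ.* x ℕ.* x ≡ x ℕ.* (x ℕ.* (x ℕ.* 1))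
      cube = ℕ-Solver.solve-∀

    Pr[Bad]*n≤1 : (Pr n (L n) (Bad G B) ^ℚ 1) * fromℕ (n ℕ.^ 1) ≤ 1ℚ
    Pr[Bad]*n≤1 = begin
      (P ^ℚ 1) * fromℕ (n ℕ.^ 1)             ≡⟨ cong₂ _*_ (*-identityʳ P) (cong fromℕ (ℕ.*-identityʳ n)) ⟩
      P * fromℕ n                            ≤⟨ *-monoʳ-≤-nonNeg (fromℕ n) {{nonNegative (fromℕ-nonNeg n)}}
                                                  (Pr-Bad≤ G B [1-pIn]^B≤½^K) ⟩
      fromℕ (L n) * (fromℕ n * c) * fromℕ n  ≡⟨ regroup (fromℕ (L n)) (fromℕ n) c ⟩
      fromℕ (L n) * fromℕ n * fromℕ n * c    ≡⟨ cong (λ x → x * fromℕ n * c) (fromℕ-homo-* (L n) n) ⟨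
      fromℕ (L n ℕ.* n) * fromℕ n * c        ≡⟨ cong (_* c) (fromℕ-homo-* (L n ℕ.* n) n) ⟨
      fromℕ (L n ℕ.* n ℕ.* n) * c            ≤⟨ *-monoʳ-≤-nonNeg c {{nonNegative (^ℚ-nonNeg K 0≤½)}}
                                                  (fromℕ-mono-≤ L*n*n≤2^K) ⟩
      fromℕ (2 ℕ.^ K) * c                    ≡⟨ *-comm (fromℕ (2 ℕ.^ K)) c ⟩
      c * fromℕ (2 ℕ.^ K)                    ≡⟨ ½^n*2^n≡1 K ⟩
      1ℚ                                     ∎
      where
      P c : ℚ
      P = Pr n (L n) (Bad G B)
      c = ½ ^ℚ K
      regroup : ∀ a b c → a * (b * c) * b ≡ a * b * b * c
      regroup = solve-∀ ℚ-ring

open import Defs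
open import Data.Nat using (ℕ; _+_; _*_; _^_; _≥_; _>_)
open import Data.Nat.Logarithm using (⌊log₂_⌋)
open import Data.Product using (∃; _×_)
open import Data.Rational using (_≤_; 1ℚ) renaming (_*_ to _*ℚ_)
open import Data.Nat using (z<s)
open import Data.Product using (_,_)
open LowDegree using (Pr[Bad]*n≤1)

lemma3 : ∃ λ C → ∃ λ r → ∃ λ a → ∃ λ b → ∃ λ n₀ →
    a > 0 × b > 0 ×
    ((n : ℕ) → n ≥ n₀ → (G : Graph n) →
      ((Pr n (L n) (Bad G (λ i → C * 2 ^ (2 ^ i) * (⌊log₂ n ⌋ + 1) ^ r)) ^ℚ b)
        *ℚ fromℕ (n ^ a)) ≤ 1ℚ)
lemma3 = 3 , 1 , 1 , 1 , 0 , z<s , z<s , λ n _ G → Pr[Bad]*n≤1 n G
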